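{- Let $D,K,N\in\mathbb{N}$ and let $\{d_n\}_{n\in\mathbb{N}}$ be a sequence of natural numbers. Writing $D_n=\prod_{i=1}^{n}d_i$, we have $$D^{N+1}\prod_{i=1}^{N}(KD_i+d_i)\;\geq\;KD\,D_N\sum_{n=1}^{N}D^n\prod_{i=1}^{n-1}(KD_i+d_i).$$
   Context: $\mathbb{N}=\{1,2,\ldots\}$; empty products equal $1$. -}

module Defs where

open import Data.Nat using (ℕ; zero; suc; _+_; _*_)

prod1 : ℕ → (ℕ → ℕ) → ℕ
prod1 zero    f = 1
prod1 (suc n) f = prod1 n f * f (suc n)

sum1 : ℕ → (ℕ → ℕ) → ℕ
sum1 zero    f = 0
sum1 (suc n) f = sum1 n f + f (suc n)

-- D_n = ∏_{i=1}^{n} d_i ; the sequence d is indexed from 1 (d 0 is ignored)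
Dprod : (ℕ → ℕ) → ℕ → ℕ
Dprod d n = prod1 n d

{-# OPTIONS --safe #-}
module Submission where

open import Defs
open import Data.Nat using (ℕ; zero; suc; _+_; _*_; _^_; _∸_; _≤_; _<_; z≤n; NonZero; >-nonZero)
open import Data.Nat.Properties using (+-monoˡ-≤; *-monoʳ-≤; m≤n⇒m≤o*n; *-assoc; *-zeroʳ; +-comm)
open import Data.Nat.Solver using (module +-*-Solver)
open import Relation.Binary.PropositionalEquality using (_≡_; refl; sym; cong; subst; subst₂; module ≡-Reasoning)
open +-*-Solver

-- Writing P_N = ∏_{i ≤ N} (K D_i + d_i) and S_N = ∑_{n ≤ N} D^n P_{n-1}, one proves
-- K D_N S_N ≤ D^N P_N by induction on N. Passing from N to N + 1 multiplies the left
-- side by d_{N+1} and adds K D_{N+1} D^{N+1} P_N; the right side becomes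
-- d_{N+1} D^{N+1} P_N plus the same cross term, so the induction hypothesis together with
-- D^N P_N ≤ D^{N+1} P_N (as D ≥ 1) closes the step. Multiplying by D gives the theorem.

module _ (D K : ℕ) .{{_ : NonZero D}} (d : ℕ → ℕ) where

  factor : ℕ → ℕ
  factor i = K * Dprod d i + d i

  weightedSum : ℕ → ℕ
  weightedSum N = sum1 N (λ n → D ^ n * prod1 (n ∸ 1) factor)

  K*Dprod*weightedSum≤D^N*prod : ∀ N → K * Dprod d N * weightedSum N ≤ D ^ N * prod1 N factor
  K*Dprod*weightedSum≤D^N*prod zero = subst (_≤ 1) (sym (*-zeroʳ (K * 1))) z≤n
  K*Dprod*weightedSum≤D^N*prod (suc N) =
    subst₂ _≤_ (sym left-unfold) (sym right-unfold) (+-monoˡ-≤ cross (*-monoʳ-≤ a ih))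
    where
      X = Dprod d N
      a = d (suc N)
      P = prod1 N factor
      s = weightedSum N
      E = D ^ N
      cross = K * X * a * D * E * P

      ih : K * X * s ≤ D * (E * P)
      ih = m≤n⇒m≤o*n D (K*Dprod*weightedSum≤D^N*prod N)

      left-unfold : K * (X * a) * (s + D * E * P) ≡ a * (K * X * s) + cross
      left-unfold = solve 7 (λ K X a s D E P →
        K :* (X :* a) :* (s :+ D :* E :* P) := a :* (K :* X :* s) :+ K :* X :* a :* D :* E :* P)
        refl K X a s D E P

      right-unfold : D * E * (P * (K * (X * a) + a)) ≡ a * (D * (E * P)) + cross
      right-unfold = solve 6 (λ K X a D E P →
        D :* E :* (P :* (K :* (X :* a) :+ a)) := a :* (D :* (E :* P)) :+ K :* X :* a :* D :* E :* P)
        refl K X a D E P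

lemma9 : (D K N : ℕ) → 0 < D → 0 < K → 0 < N → (d : ℕ → ℕ) → (∀ i → 1 ≤ i → 0 < d i) →
    K * D * Dprod d N * sum1 N (λ n → D ^ n * prod1 (n ∸ 1) (λ i → K * Dprod d i + d i))
      ≤ D ^ (N + 1) * prod1 N (λ i → K * Dprod d i + d i)
lemma9 D K N D>0 _ _ d _ =
  subst₂ _≤_ (sym left-assoc) (sym right-assoc) (*-monoʳ-≤ D bound)
  where
    instance
      D≢0 : NonZero D
      D≢0 = >-nonZero D>0
    X = Dprod d N
    s = weightedSum D K d N
    P = prod1 N (factor D K d)

    bound : K * X * s ≤ D ^ N * P
    bound = K*Dprod*weightedSum≤D^N*prod D K d N

    left-assoc : K * D * X * s ≡ D * (K * X * s)
    left-assoc = solve 4 (λ K D X s → K :* D :* X :* s := D :* (K :* X :* s)) refl K D X s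

    right-assoc : D ^ (N + 1) * P ≡ D * (D ^ N * P)
    right-assoc = begin
      D ^ (N + 1) * P   ≡⟨ cong (λ e → D ^ e * P) (+-comm N 1) ⟩
      D * D ^ N * P     ≡⟨ *-assoc D (D ^ N) P ⟩
      D * (D ^ N * P)   ∎
      where open ≡-Reasoning
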